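{- For every integer $r \geq 1$ there is $C_r > 0$ such that the following holds for every positive integer $n$. If $G$ is a graph on $N \geq C_r n^r$ vertices with no independent set of size $n$, then $\#K_{r+1}(G) \geq \frac{N}{C_r n^r} \cdot \#K_r(G)$.
   Context: For a graph $G$, $\#K_r(G)$ denotes the number of $r$-cliques (sets of $r$ pairwise adjacent vertices) in $G$; in particular $\#K_1(G)$ is the number of vertices and $\#K_2(G)$ the number of edges. -}

module Defs where

open import Data.Nat using (ℕ; zero; suc; _+_)
open import Data.Bool using (Bool; true; false; T; _∧_)
open import Data.Fin using (Fin)
open import Data.Fin.Subset using (Subset; _∈_; ∣_∣)
open import Data.Vec using (Vec; []; _∷_; tabulate)
open import Data.List using (List; []; _∷_; map; _++_; length; filterᵇ; allFin)
open import Data.Nat using (_≡ᵇ_)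
open import Data.Bool.ListAction using (and)
open import Relation.Binary.PropositionalEquality using (_≡_)
open import Relation.Nullary using (¬_)

record Graph (N : ℕ) : Set where
  field
    adj   : Fin N → Fin N → Bool
    sym   : ∀ i j → adj i j ≡ adj j i
    irrefl : ∀ i → adj i i ≡ false
open Graph public

allSubsets : (n : ℕ) → List (Subset n)
allSubsets zero = [] ∷ []
allSubsets (suc n) = map (true ∷_) (allSubsets n) ++ map (false ∷_) (allSubsets n)

memb : ∀ {n} → Subset n → Fin n → Bool
memb S i = Data.Vec.lookup S i

isCliqueᵇ : ∀ {N} → Graph N → Subset N → Bool
isCliqueᵇ {N} G S =
  and (map (λ i → and (map (λ j → impl (memb S i ∧ memb S j ∧ not≡ i j) (adj G i j)) (allFin N))) (allFin N))
  where
    open import Data.Bool using (not; _∨_)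
    impl : Bool → Bool → Bool
    impl a b = not a ∨ b
    not≡ : Fin N → Fin N → Bool
    not≡ i j = not (Data.Fin.toℕ i ≡ᵇ Data.Fin.toℕ j)

#K : ℕ → ∀ {N} → Graph N → ℕ
#K r {N} G = length (filterᵇ (λ S → (∣ S ∣ ≡ᵇ r) ∧ isCliqueᵇ G S) (allSubsets N))

IsIndependent : ∀ {N} → Graph N → Subset N → Set
IsIndependent G S = ∀ i j → i ∈ S → j ∈ S → adj G i j ≡ false

NoIndependentSetOfSize : ∀ {N} → ℕ → Graph N → Set
NoIndependentSetOfSize n G = ∀ S → ∣ S ∣ ≡ n → ¬ IsIndependent G S

-- Count the r-cliques of a symmetric irreflexive relation on a list recursively: an
-- (r+1)-clique either avoids the head x or is x together with an r-clique of the
-- neighbourhood of x.  Summing the r-clique counts of all neighbourhoods counts every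
-- (r+1)-clique r+1 times.  Without an independent n-set a greedy deletion argument gives
-- at least a·|V| − n·a² edges for every a, and applying this inside every neighbourhood
-- and summing yields
--   2a(s+1)·k(s+1) ≤ (s+1)(s+2)·k(s+2) + 2na²·k(s).
-- Inductively N·k(s) ≤ C(s)·n^s·k(s+1), so for a ≈ N / (2·C(s)·n^(s+1)) the last term is
-- at most a·N·k(s+1) and is absorbed, leaving a·k(s+1) ≤ (s+2)·k(s+2); this gives the
-- theorem with C(s+1) = 4(s+2)·C(s).

module Submission where

open import Defs hiding (sym)
open import Data.Bool using (Bool; true; false; not; _∧_; _∨_; T; if_then_else_)
open import Data.Bool.Properties using (∧-comm; T-∧; T-≡; T-not-≡)
open import Data.Bool.ListAction using (all)
open import Data.Empty using (⊥-elim)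
open import Data.Fin using (Fin; zero; suc; toℕ; _≟_)
open import Data.Fin.Properties using (toℕ-injective; suc-injective)
open import Data.Fin.Subset using (Subset; _∈_; ∣_∣)
open import Data.List using (List; []; _∷_; map; length; filter; filterᵇ; allFin; tabulate; _++_)
open import Data.List.Properties using (filter-≐; filter-++; filter-none; filter-all; length-++; length-map; length-tabulate; map-tabulate)
open import Data.List.Relation.Binary.Sublist.Propositional using (_⊆_; []; _∷_; _∷ʳ_)
open import Data.List.Relation.Binary.Sublist.Propositional.Properties using (filter⁺; filter-⊆)
open import Data.List.Relation.Unary.All as All using (All)
open import Data.List.Relation.Unary.All.Properties using (all⁺; all⁻; tabulate⁺; tabulate⁻)
open import Data.Nat using (ℕ; zero; suc; _+_; _*_; _^_; _≤_; _≥_; z≤n; s≤s; _≤?_; _≡ᵇ_; NonZero; >-nonZero; >-nonZero⁻¹)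
open import Data.Nat.DivMod using (_/_; _%_; m≡m%n+[m/n]*n; m%n<n; m/n*n≤m; m≥n⇒m/n>0)
open import Data.Nat.ListAction using (sum)
open import Data.Nat.Properties as ℕ hiding (suc-injective; _≟_)
open import Data.Nat.Tactic.RingSolver using (solve-∀)
open import Data.Product using (∃-syntax; _×_; _,_; proj₁; proj₂)
open import Data.Unit using (tt)
open import Data.Vec using ([]; _∷_; lookup; here; there)
open import Data.Vec.Properties using ([]=⇒lookup; lookup⇒[]=)
open import Function using (_∘_; _on_; _⇔_; mk⇔; Equivalence)
open import Relation.Binary.PropositionalEquality
open import Relation.Nullary using (¬_; does; yes; no)
open import Relation.Nullary.Decidable as Dec using (T?)
open import Relation.Unary using (Pred; Decidable)

open Equivalence

private
  variable
    A B : Set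
    N : ℕ

filterᵇ-cong : {p q : A → Bool} → (∀ x → p x ≡ q x) → ∀ xs → filterᵇ p xs ≡ filterᵇ q xs
filterᵇ-cong p≗q [] = refl
filterᵇ-cong {q = q} p≗q (x ∷ xs) rewrite p≗q x with q x
... | true  = cong (x ∷_) (filterᵇ-cong p≗q xs)
... | false = filterᵇ-cong p≗q xs

filterᵇ-true : (xs : List A) → filterᵇ (λ _ → true) xs ≡ xs
filterᵇ-true xs = filter-all (T? ∘ λ _ → true) (All.universal _ xs)

filterᵇ-filterᵇ : ∀ (p q : A → Bool) xs → filterᵇ p (filterᵇ q xs) ≡ filterᵇ (λ x → q x ∧ p x) xs
filterᵇ-filterᵇ p q [] = refl
filterᵇ-filterᵇ p q (x ∷ xs) with q x
... | false = filterᵇ-filterᵇ p q xs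
... | true with p x
...   | true  = cong (x ∷_) (filterᵇ-filterᵇ p q xs)
...   | false = filterᵇ-filterᵇ p q xs

filterᵇ-comm : ∀ (p q : A → Bool) xs → filterᵇ p (filterᵇ q xs) ≡ filterᵇ q (filterᵇ p xs)
filterᵇ-comm p q xs = begin
  filterᵇ p (filterᵇ q xs)          ≡⟨ filterᵇ-filterᵇ p q xs ⟩
  filterᵇ (λ x → q x ∧ p x) xs      ≡⟨ filterᵇ-cong (λ x → ∧-comm (q x) (p x)) xs ⟩
  filterᵇ (λ x → p x ∧ q x) xs      ≡⟨ filterᵇ-filterᵇ q p xs ⟨
  filterᵇ q (filterᵇ p xs)          ∎
  where open ≡-Reasoning

filter-map : ∀ {ℓ} {P : Pred B ℓ} (P? : Decidable P) (f : A → B) xs →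
             filter P? (map f xs) ≡ map f (filter (P? ∘ f) xs)
filter-map P? f [] = refl
filter-map P? f (x ∷ xs) with does (P? (f x))
... | true  = cong (f x ∷_) (filter-map P? f xs)
... | false = filter-map P? f xs

length-filterᵇ-not : ∀ (p : A → Bool) xs → length xs ≡ length (filterᵇ p xs) + length (filterᵇ (not ∘ p) xs)
length-filterᵇ-not p [] = refl
length-filterᵇ-not p (x ∷ xs) with p x
... | true  = cong suc (length-filterᵇ-not p xs)
... | false = trans (cong suc (length-filterᵇ-not p xs)) (sym (+-suc _ _))

sum-map-+ : ∀ (f g : A → ℕ) xs → sum (map (λ x → f x + g x) xs) ≡ sum (map f xs) + sum (map g xs)
sum-map-+ f g [] = refl
sum-map-+ f g (x ∷ xs) rewrite sum-map-+ f g xs = +-+-comm (f x) (g x) _ _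
  where +-+-comm : ∀ a b c d → (a + b) + (c + d) ≡ (a + c) + (b + d)
        +-+-comm = solve-∀

sum-map-*ˡ : ∀ c (f : A → ℕ) xs → sum (map (λ x → c * f x) xs) ≡ c * sum (map f xs)
sum-map-*ˡ c f [] = sym (*-zeroʳ c)
sum-map-*ˡ c f (x ∷ xs) rewrite sum-map-*ˡ c f xs = sym (*-distribˡ-+ c (f x) _)

sum-map-mono : {f g : A → ℕ} → (∀ x → f x ≤ g x) → ∀ xs → sum (map f xs) ≤ sum (map g xs)
sum-map-mono f≤g [] = z≤n
sum-map-mono f≤g (x ∷ xs) = +-mono-≤ (f≤g x) (sum-map-mono f≤g xs)

sum-map-cong : {f g : A → ℕ} → (∀ x → f x ≡ g x) → ∀ xs → sum (map f xs) ≡ sum (map g xs)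
sum-map-cong f≗g [] = refl
sum-map-cong f≗g (x ∷ xs) = cong₂ _+_ (f≗g x) (sum-map-cong f≗g xs)

sum-map-if : ∀ (p : A → Bool) (f : A → ℕ) xs →
             sum (map (λ x → if p x then f x else 0) xs) ≡ sum (map f (filterᵇ p xs))
sum-map-if p f [] = refl
sum-map-if p f (x ∷ xs) with p x
... | true  = cong (f x +_) (sum-map-if p f xs)
... | false = sum-map-if p f xs

sum-map-1 : ∀ (xs : List A) → sum (map (λ _ → 1) xs) ≡ length xs
sum-map-1 [] = refl
sum-map-1 (x ∷ xs) = cong suc (sum-map-1 xs)

-- Cliques in a list

cliques : (A → A → Bool) → ℕ → List A → ℕ
cliques R zero    xs       = 1
cliques R (suc r) []       = 0
cliques R (suc r) (x ∷ xs) = cliques R (suc r) xs + cliques R r (filterᵇ (R x) xs)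

cliques-one : ∀ (R : A → A → Bool) xs → cliques R 1 xs ≡ length xs
cliques-one R [] = refl
cliques-one R (x ∷ xs) = trans (+-comm (cliques R 1 xs) 1) (cong suc (cliques-one R xs))

cliques-map : ∀ (R : B → B → Bool) (f : A → B) r xs → cliques R r (map f xs) ≡ cliques (R on f) r xs
cliques-map R f zero    xs       = refl
cliques-map R f (suc r) []       = refl
cliques-map R f (suc r) (x ∷ xs) = cong₂ _+_ (cliques-map R f (suc r) xs) (begin
  cliques R r (filterᵇ (R (f x)) (map f xs))    ≡⟨ cong (cliques R r) (filter-map (T? ∘ R (f x)) f xs) ⟩
  cliques R r (map f (filterᵇ (R (f x) ∘ f) xs)) ≡⟨ cliques-map R f r _ ⟩
  cliques (R on f) r (filterᵇ ((R on f) x) xs)  ∎)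
  where open ≡-Reasoning

cliques-mono : ∀ (R : A → A → Bool) r {xs ys} → xs ⊆ ys → cliques R r xs ≤ cliques R r ys
cliques-mono R zero    _          = ≤-refl
cliques-mono R (suc r) []         = ≤-refl
cliques-mono R (suc r) (y ∷ʳ xs⊆ys) = ≤-trans (cliques-mono R (suc r) xs⊆ys) (m≤m+n _ _)
cliques-mono R (suc r) (_∷_ {x} refl xs⊆ys) =
  +-mono-≤ (cliques-mono R (suc r) xs⊆ys)
           (cliques-mono R r (filter⁺ (T? ∘ R x) (T? ∘ R x) (λ { refl t → t }) xs⊆ys))

cliques-filterᵇ-≤ : ∀ (R : A → A → Bool) r p xs → cliques R r (filterᵇ p xs) ≤ cliques R r xs
cliques-filterᵇ-≤ R r p xs = cliques-mono R r (filter-⊆ (T? ∘ p) xs)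

module _ (R : A → A → Bool) (R-sym : ∀ x y → R x y ≡ R y x) (R-irrefl : ∀ x → R x x ≡ false) where

  private
    cliques-neighbours-∷ : ∀ r x v xs →
      cliques R (suc r) (filterᵇ (R v) (x ∷ xs)) ≡
      cliques R (suc r) (filterᵇ (R v) xs) + (if R x v then cliques R r (filterᵇ (R v) (filterᵇ (R x) xs)) else 0)
    cliques-neighbours-∷ r x v xs rewrite R-sym v x with R x v
    ... | true  = cong (cliques R (suc r) (filterᵇ (R v) xs) +_) (cong (cliques R r) (filterᵇ-comm (R x) (R v) xs))
    ... | false = sym (+-identityʳ _)

    neighbours-∷-self : ∀ x xs → filterᵇ (R x) (x ∷ xs) ≡ filterᵇ (R x) xs
    neighbours-∷-self x xs rewrite R-irrefl x = refl

  cliques-handshake : ∀ r xs → sum (map (λ v → cliques R r (filterᵇ (R v) xs)) xs) ≡ suc r * cliques R (suc r) xs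
  cliques-handshake zero xs = begin
    sum (map (λ _ → 1) xs)  ≡⟨ sum-map-1 xs ⟩
    length xs               ≡⟨ cliques-one R xs ⟨
    cliques R 1 xs          ≡⟨ +-identityʳ _ ⟨
    1 * cliques R 1 xs      ∎
    where open ≡-Reasoning
  cliques-handshake (suc r) [] = sym (*-zeroʳ (suc (suc r)))
  cliques-handshake (suc r) (x ∷ xs) = begin
    cliques R (suc r) (filterᵇ (R x) (x ∷ xs)) + sum (map (λ v → cliques R (suc r) (filterᵇ (R v) (x ∷ xs))) xs)
      ≡⟨ cong₂ _+_ (cong (cliques R (suc r)) (neighbours-∷-self x xs))
                   (sum-map-cong (λ v → cliques-neighbours-∷ r x v xs) xs) ⟩
    c + Σ (λ v → cliques R (suc r) (filterᵇ (R v) xs) + (if R x v then k v else 0))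
      ≡⟨ cong (c +_) (sum-map-+ _ _ xs) ⟩
    c + (Σ (λ v → cliques R (suc r) (filterᵇ (R v) xs)) + Σ (λ v → if R x v then k v else 0))
      ≡⟨ cong (λ t → c + (_ + t)) (sum-map-if (R x) k xs) ⟩
    c + (Σ (λ v → cliques R (suc r) (filterᵇ (R v) xs)) + sum (map k (filterᵇ (R x) xs)))
      ≡⟨ cong₂ (λ t u → c + (t + u)) (cliques-handshake (suc r) xs) (cliques-handshake r (filterᵇ (R x) xs)) ⟩
    c + (suc (suc r) * cliques R (suc (suc r)) xs + suc r * c)
      ≡⟨ regroup (suc r) (cliques R (suc (suc r)) xs) c ⟩
    suc (suc r) * (cliques R (suc (suc r)) xs + c)
      ∎
    where
      open ≡-Reasoning
      Σ : (A → ℕ) → ℕ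
      Σ f = sum (map f xs)
      c : ℕ
      c = cliques R (suc r) (filterᵇ (R x) xs)
      k : A → ℕ
      k v = cliques R r (filterᵇ (R v) (filterᵇ (R x) xs))
      regroup : ∀ s a c → c + (suc s * a + s * c) ≡ suc s * (a + c)
      regroup = solve-∀

-- Clique-count inequalities

complement : (A → A → Bool) → A → A → Bool
complement R x y = not (R x y)

-- If x has at least a neighbours, delete x and pay for it with these edges; otherwise
-- keep only the non-neighbours of x, which have no independent set of one size less.
private
  edge-bound-∷ : ∀ (R : A → A → Bool) a m x xs →
    a * length xs ≤ cliques R 2 xs + suc m * (a * a) →
    a * length (filterᵇ (complement R x) xs) ≤ cliques R 2 (filterᵇ (complement R x) xs) + m * (a * a) →
    a * length (x ∷ xs) ≤ cliques R 2 (x ∷ xs) + suc m * (a * a)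
  edge-bound-∷ {A} R a m x xs bound-xs bound-nonNeighbours
    rewrite cliques-one R (filterᵇ (R x) xs) with a ≤? length (filterᵇ (R x) xs)
  ... | yes a≤deg = begin
    a * suc (length xs)                     ≡⟨ *-suc a _ ⟩
    a + a * length xs                       ≤⟨ +-mono-≤ a≤deg bound-xs ⟩
    deg + (e + suc m * (a * a))             ≡⟨ shuffle deg e _ ⟩
    (e + deg) + suc m * (a * a)             ∎
    where
      open ≤-Reasoning
      deg e : ℕ
      deg = length (filterᵇ (R x) xs)
      e = cliques R 2 xs
      shuffle : ∀ d e t → d + (e + t) ≡ (e + d) + t
      shuffle = solve-∀
  ... | no a≰deg = begin
    a * suc (length xs)                         ≡⟨ cong (λ l → a * suc l) (length-filterᵇ-not (R x) xs) ⟩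
    a * suc (deg + length nonNeighbours)        ≡⟨ distrib a deg (length nonNeighbours) ⟩
    a * suc deg + a * length nonNeighbours      ≤⟨ +-mono-≤ (*-monoʳ-≤ a (≰⇒> a≰deg)) bound-nonNeighbours ⟩
    a * a + (cliques R 2 nonNeighbours + m * (a * a))
                                                ≤⟨ +-monoʳ-≤ (a * a) (+-monoˡ-≤ _ (cliques-filterᵇ-≤ R 2 _ xs)) ⟩
    a * a + (e + m * (a * a))                   ≤⟨ +-monoʳ-≤ (a * a) (+-monoˡ-≤ _ (m≤m+n e deg)) ⟩
    a * a + ((e + deg) + m * (a * a))           ≡⟨ shuffle (a * a) (e + deg) _ ⟩
    (e + deg) + (a * a + m * (a * a))           ∎
    where
      open ≤-Reasoning
      nonNeighbours : List A
      nonNeighbours = filterᵇ (complement R x) xs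
      deg e : ℕ
      deg = length (filterᵇ (R x) xs)
      e = cliques R 2 xs
      distrib : ∀ a d l → a * suc (d + l) ≡ a * suc d + a * l
      distrib = solve-∀
      shuffle : ∀ q s t → q + (s + t) ≡ s + (q + t)
      shuffle = solve-∀

independence-edge-bound : ∀ (R : A → A → Bool) a n xs → cliques (complement R) n xs ≡ 0 →
                          a * length xs ≤ cliques R 2 xs + n * (a * a)
independence-edge-bound R a zero    xs       ()
independence-edge-bound R a (suc m) []       _  = ≤-trans (≤-reflexive (*-zeroʳ a)) z≤n
independence-edge-bound R a (suc m) (x ∷ xs) no-indep =
  edge-bound-∷ R a m x xs (independence-edge-bound R a (suc m) xs (m+n≡0⇒m≡0 _ no-indep))
                          (independence-edge-bound R a m _ (m+n≡0⇒n≡0 _ no-indep))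

module _ (R : A → A → Bool) (R-sym : ∀ x y → R x y ≡ R y x) (R-irrefl : ∀ x → R x x ≡ false) (n a : ℕ) where

  cliques-supersaturation : ∀ s ys → cliques (complement R) n ys ≡ 0 →
    2 * a * suc s * cliques R (suc s) ys ≤ suc s * suc (suc s) * cliques R (suc (suc s)) ys + 2 * (n * (a * a)) * cliques R s ys
  cliques-supersaturation zero ys no-indep = begin
    2 * a * 1 * cliques R 1 ys                ≡⟨ cong (2 * a * 1 *_) (cliques-one R ys) ⟩
    2 * a * 1 * length ys                     ≡⟨ reassoc a (length ys) ⟩
    2 * (a * length ys)                       ≤⟨ *-monoʳ-≤ 2 (independence-edge-bound R a n ys no-indep) ⟩
    2 * (cliques R 2 ys + n * (a * a))        ≡⟨ distrib (cliques R 2 ys) (n * (a * a)) ⟩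
    1 * 2 * cliques R 2 ys + 2 * (n * (a * a)) * 1  ∎
    where
      open ≤-Reasoning
      reassoc : ∀ a l → 2 * a * 1 * l ≡ 2 * (a * l)
      reassoc = solve-∀
      distrib : ∀ e b → 2 * (e + b) ≡ 1 * 2 * e + 2 * b * 1
      distrib = solve-∀
  cliques-supersaturation (suc s) ys no-indep = *-cancelˡ-≤ (suc s) (begin
    suc s * (2 * a * suc (suc s) * k₂)                   ≡⟨ reassoc s a k₂ ⟩
    2 * a * suc s * (suc (suc s) * k₂)                   ≡⟨ cong (2 * a * suc s *_) (cliques-handshake R R-sym R-irrefl (suc s) ys) ⟨
    2 * a * suc s * Σ (λ v → cliques R (suc s) (nbhd v))    ≡⟨ sum-map-*ˡ (2 * a * suc s) _ ys ⟨
    Σ (λ v → 2 * a * suc s * cliques R (suc s) (nbhd v))    ≤⟨ sum-map-mono (λ v → cliques-supersaturation s (nbhd v) (no-indep-nbhd v)) ys ⟩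
    Σ (λ v → suc s * suc (suc s) * cliques R (suc (suc s)) (nbhd v) + 2 * b * cliques R s (nbhd v))
                                                         ≡⟨ sum-map-+ _ _ ys ⟩
    Σ (λ v → suc s * suc (suc s) * cliques R (suc (suc s)) (nbhd v)) + Σ (λ v → 2 * b * cliques R s (nbhd v))
                                                         ≡⟨ cong₂ _+_ (sum-map-*ˡ (suc s * suc (suc s)) _ ys) (sum-map-*ˡ (2 * b) _ ys) ⟩
    suc s * suc (suc s) * Σ (λ v → cliques R (suc (suc s)) (nbhd v)) + 2 * b * Σ (λ v → cliques R s (nbhd v))
                                                         ≡⟨ cong₂ (λ p q → suc s * suc (suc s) * p + 2 * b * q)
                                                                  (cliques-handshake R R-sym R-irrefl (suc (suc s)) ys)
                                                                  (cliques-handshake R R-sym R-irrefl s ys) ⟩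
    suc s * suc (suc s) * (suc (suc (suc s)) * k₃) + 2 * b * (suc s * k₁)
                                                         ≡⟨ factor s b k₃ k₁ ⟩
    suc s * (suc (suc s) * suc (suc (suc s)) * k₃ + 2 * b * k₁) ∎)
    where
      open ≤-Reasoning
      b k₁ k₂ k₃ : ℕ
      b = n * (a * a)
      k₁ = cliques R (suc s) ys
      k₂ = cliques R (suc (suc s)) ys
      k₃ = cliques R (suc (suc (suc s))) ys
      nbhd : A → List A
      nbhd v = filterᵇ (R v) ys
      Σ : (A → ℕ) → ℕ
      Σ f = sum (map f ys)
      no-indep-nbhd : ∀ v → cliques (complement R) n (nbhd v) ≡ 0
      no-indep-nbhd v =
        n≤0⇒n≡0 (subst (cliques (complement R) n (nbhd v) ≤_) no-indep (cliques-filterᵇ-≤ (complement R) n (R v) ys))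
      reassoc : ∀ s a k → suc s * (2 * a * suc (suc s) * k) ≡ 2 * a * suc s * (suc (suc s) * k)
      reassoc = solve-∀
      factor : ∀ s b k₃ k₁ → suc s * suc (suc s) * (suc (suc (suc s)) * k₃) + 2 * b * (suc s * k₁)
                             ≡ suc s * (suc (suc s) * suc (suc (suc s)) * k₃ + 2 * b * k₁)
      factor = solve-∀

≤2*[m/n]*n : ∀ m n .{{_ : NonZero n}} → n ≤ m → m ≤ 2 * (m / n * n)
≤2*[m/n]*n m n n≤m = begin
  m                         ≡⟨ m≡m%n+[m/n]*n m n ⟩
  m % n + m / n * n         ≤⟨ +-monoˡ-≤ _ (<⇒≤ (m%n<n m n)) ⟩
  n + m / n * n             ≤⟨ +-monoˡ-≤ _ (m≤n*m n (m / n) {{>-nonZero (m≥n⇒m/n>0 n≤m)}}) ⟩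
  m / n * n + m / n * n     ≡⟨ cong (m / n * n +_) (+-identityʳ _) ⟨
  2 * (m / n * n)           ∎
  where open ≤-Reasoning

2*[1+s]*p≤[1+s]*q+p⇒p≤q : ∀ s {p q} → 2 * suc s * p ≤ suc s * q + p → p ≤ q
2*[1+s]*p≤[1+s]*q+p⇒p≤q s {p} {q} h = *-cancelˡ-≤ (suc s) (+-cancelʳ-≤ p _ _ (begin
  suc s * p + p          ≤⟨ +-monoʳ-≤ (suc s * p) (m≤n*m p (suc s)) ⟩
  suc s * p + suc s * p  ≡⟨ double (suc s) p ⟨
  2 * suc s * p          ≤⟨ h ⟩
  suc s * q + p          ∎))
  where
    open ≤-Reasoning
    double : ∀ t p → 2 * t * p ≡ t * p + t * p
    double = solve-∀

private
  cliques-ratio-step : ∀ s {N a n C X k₀ k₁ k₂} .{{_ : NonZero N}} →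
    a * (2 * (C * (n * X))) ≤ N →
    N * k₀ ≤ C * X * k₁ →
    2 * a * suc s * k₁ ≤ suc s * suc (suc s) * k₂ + 2 * (n * (a * a)) * k₀ →
    a * k₁ ≤ suc (suc s) * k₂
  cliques-ratio-step s {N} {a} {n} {C} {X} {k₀} {k₁} {k₂} a2M≤N induction supersaturation =
    *-cancelˡ-≤ N (2*[1+s]*p≤[1+s]*q+p⇒p≤q s (begin
      2 * suc s * (N * (a * k₁))                                          ≡⟨ ring₁ s N a k₁ ⟩
      N * (2 * a * suc s * k₁)                                            ≤⟨ *-monoʳ-≤ N supersaturation ⟩
      N * (suc s * suc (suc s) * k₂ + 2 * (n * (a * a)) * k₀)             ≡⟨ ring₂ s N a n k₀ k₂ ⟩
      suc s * (N * (suc (suc s) * k₂)) + 2 * (a * a) * n * (N * k₀)       ≤⟨ +-monoʳ-≤ _ (*-monoʳ-≤ (2 * (a * a) * n) induction) ⟩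
      suc s * (N * (suc (suc s) * k₂)) + 2 * (a * a) * n * (C * X * k₁)   ≡⟨ cong (suc s * (N * (suc (suc s) * k₂)) +_) (ring₃ a n C X k₁) ⟩
      suc s * (N * (suc (suc s) * k₂)) + a * (2 * (C * (n * X))) * (a * k₁)
                                                                          ≤⟨ +-monoʳ-≤ _ (*-monoˡ-≤ (a * k₁) a2M≤N) ⟩
      suc s * (N * (suc (suc s) * k₂)) + N * (a * k₁)                     ∎))
    where
      open ≤-Reasoning
      ring₁ : ∀ s N a k → 2 * suc s * (N * (a * k)) ≡ N * (2 * a * suc s * k)
      ring₁ = solve-∀
      ring₂ : ∀ s N a n k₀ k₂ → N * (suc s * suc (suc s) * k₂ + 2 * (n * (a * a)) * k₀)
                                ≡ suc s * (N * (suc (suc s) * k₂)) + 2 * (a * a) * n * (N * k₀)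
      ring₂ = solve-∀
      ring₃ : ∀ a n C X k → 2 * (a * a) * n * (C * X * k) ≡ a * (2 * (C * (n * X))) * (a * k)
      ring₃ = solve-∀

cliqueRatioConstant : ℕ → ℕ
cliqueRatioConstant zero    = 1
cliqueRatioConstant (suc r) = 4 * suc (suc r) * cliqueRatioConstant r

cliqueRatioConstant-positive : ∀ r → 1 ≤ cliqueRatioConstant r
cliqueRatioConstant-positive zero    = ≤-refl
cliqueRatioConstant-positive (suc r) = ≤-trans (cliqueRatioConstant-positive r) (m≤n*m _ (4 * suc (suc r)))

cliques-ratio : ∀ (R : A → A → Bool) → (∀ x y → R x y ≡ R y x) → (∀ x → R x x ≡ false) →
  ∀ r n xs → cliqueRatioConstant r * n ^ r ≤ length xs → cliques (complement R) n xs ≡ 0 →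
  length xs * cliques R r xs ≤ cliqueRatioConstant r * n ^ r * cliques R (suc r) xs
cliques-ratio R R-sym R-irrefl zero n xs _ _ =
  ≤-reflexive (trans (*-identityʳ (length xs)) (sym (trans (+-identityʳ _) (cliques-one R xs))))
cliques-ratio R R-sym R-irrefl (suc s) zero xs _ ()
cliques-ratio R R-sym R-irrefl (suc s) n@(suc _) xs large no-indep = begin
  |xs| * k₁                             ≤⟨ *-monoˡ-≤ k₁ (≤2*[m/n]*n |xs| (2 * M) 2M≤|xs|) ⟩
  2 * (a * (2 * M)) * k₁                ≡⟨ ring₁ a M k₁ ⟩
  4 * M * (a * k₁)                      ≤⟨ *-monoʳ-≤ (4 * M) key ⟩
  4 * M * (suc (suc s) * k₂)            ≡⟨ ring₂ s C (n ^ suc s) k₂ ⟩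
  4 * suc (suc s) * C * n ^ suc s * k₂  ∎
  where
    open ≤-Reasoning
    |xs| C M k₁ k₂ : ℕ
    |xs| = length xs
    C = cliqueRatioConstant s
    M = C * n ^ suc s
    k₁ = cliques R (suc s) xs
    k₂ = cliques R (suc (suc s)) xs
    instance
      M-nonZero : NonZero M
      M-nonZero = >-nonZero (*-mono-≤ (cliqueRatioConstant-positive s) (m^n>0 n (suc s)))
      2M-nonZero : NonZero (2 * M)
      2M-nonZero = >-nonZero (≤-trans (>-nonZero⁻¹ M) (m≤m+n M _))
    4[2+s]M≤|xs| : 4 * suc (suc s) * M ≤ |xs|
    4[2+s]M≤|xs| = subst (_≤ |xs|) (*-assoc (4 * suc (suc s)) C (n ^ suc s)) large
    M≤|xs| : M ≤ |xs|
    M≤|xs| = ≤-trans (m≤n*m M (4 * suc (suc s))) 4[2+s]M≤|xs|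
    2M≤|xs| : 2 * M ≤ |xs|
    2M≤|xs| = ≤-trans (*-monoˡ-≤ M {2} {4 * suc (suc s)} (s≤s (s≤s z≤n))) 4[2+s]M≤|xs|
    instance
      |xs|-nonZero : NonZero |xs|
      |xs|-nonZero = >-nonZero (≤-trans (>-nonZero⁻¹ M) M≤|xs|)
    -- 2aM ≤ |xs| ≤ 4aM: the lower bound absorbs the last term of cliques-supersaturation,
    -- the upper bound turns a·k₁ ≤ (s+2)·k₂ into the claim.
    a : ℕ
    a = |xs| / (2 * M)
    key : a * k₁ ≤ suc (suc s) * k₂
    key = cliques-ratio-step s {|xs|} {a} {n} {C} {n ^ s} {k₂ = k₂} (m/n*n≤m |xs| (2 * M))
      (cliques-ratio R R-sym R-irrefl s n xs (≤-trans (*-monoʳ-≤ C (m≤n*m (n ^ s) n)) M≤|xs|) no-indep)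
      (cliques-supersaturation R R-sym R-irrefl n a s xs no-indep)
    ring₁ : ∀ a M k → 2 * (a * (2 * M)) * k ≡ 4 * M * (a * k)
    ring₁ = solve-∀
    ring₂ : ∀ s C Y k → 4 * (C * Y) * (suc (suc s) * k) ≡ 4 * suc (suc s) * C * Y * k
    ring₂ = solve-∀

-- Cliques as subsets of Fin N

T-all-allFin : (p : Fin N → Bool) → T (all p (allFin N)) ⇔ (∀ i → T (p i))
T-all-allFin {N} p = mk⇔ (λ t → tabulate⁻ (all⁺ p (allFin N) t)) (λ f → all⁻ p (tabulate⁺ f))

T-implication : ∀ a b c d → T (not (a ∧ b ∧ c) ∨ d) ⇔ (T a → T b → T c → T d)
T-implication true  true  true  d = mk⇔ (λ t _ _ _ → t) (λ f → f _ _ _)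
T-implication true  true  false d = mk⇔ (λ _ _ _ ()) _
T-implication true  false c     d = mk⇔ (λ _ _ ()) _
T-implication false b     c     d = mk⇔ (λ _ ()) _

T-lookup : (S : Subset N) (i : Fin N) → T (lookup S i) ⇔ i ∈ S
T-lookup S i = mk⇔ (lookup⇒[]= i S ∘ to T-≡) (from T-≡ ∘ []=⇒lookup)

T-not-≡ᵇ : (i j : Fin N) → T (not (toℕ i ≡ᵇ toℕ j)) ⇔ (i ≢ j)
T-not-≡ᵇ i j with toℕ i ≡ᵇ toℕ j in eq
... | true  = mk⇔ (λ ()) (λ i≢j → i≢j (toℕ-injective (≡ᵇ⇒≡ _ _ (subst T (sym eq) tt))))
... | false = mk⇔ (λ _ i≡j → subst T eq (≡⇒≡ᵇ _ _ (cong toℕ i≡j))) _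

IsClique : (Fin N → Fin N → Bool) → Subset N → Set
IsClique R S = ∀ i j → i ∈ S → j ∈ S → i ≢ j → T (R i j)

isCliqueᵇ-correct : (G : Graph N) (S : Subset N) → T (isCliqueᵇ G S) ⇔ IsClique (adj G) S
isCliqueᵇ-correct {N} G S = mk⇔
  (λ t i j i∈S j∈S i≢j → to (T-implication _ _ _ _) (to (T-all-allFin _) (to (T-all-allFin row) t i) j)
                               (from (T-lookup S i) i∈S) (from (T-lookup S j) j∈S) (from (T-not-≡ᵇ i j) i≢j))
  (λ clique → from (T-all-allFin row) λ i → from (T-all-allFin _) λ j → from (T-implication _ _ _ _)
                 λ i∈S j∈S i≢j → clique i j (to (T-lookup S i) i∈S) (to (T-lookup S j) j∈S) (to (T-not-≡ᵇ i j) i≢j))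
  where
    row : Fin N → Bool
    row i = all (λ j → not (lookup S i ∧ lookup S j ∧ not (toℕ i ≡ᵇ toℕ j)) ∨ adj G i j) (allFin N)

CliqueWithin : (Fin N → Fin N → Bool) → (Fin N → Bool) → ℕ → Subset N → Set
CliqueWithin R U r S = ∣ S ∣ ≡ r × IsClique R S × (∀ i → i ∈ S → T (U i))

module _ (R : Fin (suc N) → Fin (suc N) → Bool) (U : Fin (suc N) → Bool) (S : Subset N) where

  cliqueWithin-false∷ : ∀ {r} → CliqueWithin R U r (false ∷ S) ⇔ CliqueWithin (R on suc) (U ∘ suc) r S
  cliqueWithin-false∷ = mk⇔
    (λ (size , clique , within) →
       size , (λ i j i∈ j∈ i≢j → clique (suc i) (suc j) (there i∈) (there j∈) (i≢j ∘ suc-injective)) ,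
       λ i i∈ → within (suc i) (there i∈))
    (λ (size , clique , within) → size , extend clique , λ { (suc i) (there i∈) → within i i∈ })
    where
      extend : IsClique (R on suc) S → IsClique R (false ∷ S)
      extend clique (suc i) (suc j) (there i∈) (there j∈) i≢j = clique i j i∈ j∈ (i≢j ∘ cong suc)

  cliqueWithin-true∷ : (∀ i j → R i j ≡ R j i) → ∀ {r} →
    CliqueWithin R U (suc r) (true ∷ S) ⇔ (T (U zero) × CliqueWithin (R on suc) (λ j → U (suc j) ∧ R zero (suc j)) r S)
  cliqueWithin-true∷ R-sym = mk⇔
    (λ (size , clique , within) → within zero here , ℕ.suc-injective size ,
       (λ i j i∈ j∈ i≢j → clique (suc i) (suc j) (there i∈) (there j∈) (i≢j ∘ suc-injective)) ,
       (λ j j∈ → from T-∧ (within (suc j) (there j∈) , clique zero (suc j) here (there j∈) λ ())))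
    (λ (u₀ , size , clique , within) →
       cong suc size , extend clique within ,
       λ { zero here → u₀ ; (suc i) (there i∈) → proj₁ (to T-∧ (within i i∈)) })
    where
      extend : IsClique (R on suc) S → (∀ j → j ∈ S → T (U (suc j) ∧ R zero (suc j))) → IsClique R (true ∷ S)
      extend clique within zero    zero    here       here       0≢0 = ⊥-elim (0≢0 refl)
      extend clique within zero    (suc j) here       (there j∈) _   = proj₂ (to T-∧ (within j j∈))
      extend clique within (suc i) zero    (there i∈) here       _   = subst T (R-sym zero (suc i)) (proj₂ (to T-∧ (within i i∈)))
      extend clique within (suc i) (suc j) (there i∈) (there j∈) i≢j = clique i j i∈ j∈ (i≢j ∘ cong suc)

countSubsets : ∀ {ℓ} {P : Pred (Subset N) ℓ} → Decidable P → ℕ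
countSubsets {N} P? = length (filter P? (allSubsets N))

countSubsets-suc : ∀ {ℓ} {P : Pred (Subset (suc N)) ℓ} (P? : Decidable P) →
  countSubsets P? ≡ countSubsets (P? ∘ (true ∷_)) + countSubsets (P? ∘ (false ∷_))
countSubsets-suc {N} P? = begin
  length (filter P? (map (true ∷_) Ss ++ map (false ∷_) Ss))
    ≡⟨ cong length (filter-++ P? (map (true ∷_) Ss) (map (false ∷_) Ss)) ⟩
  length (filter P? (map (true ∷_) Ss) ++ filter P? (map (false ∷_) Ss))
    ≡⟨ length-++ (filter P? (map (true ∷_) Ss)) ⟩
  length (filter P? (map (true ∷_) Ss)) + length (filter P? (map (false ∷_) Ss))
    ≡⟨ cong₂ _+_ (count-∷ true) (count-∷ false) ⟩
  countSubsets (P? ∘ (true ∷_)) + countSubsets (P? ∘ (false ∷_))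
    ∎
  where
    open ≡-Reasoning
    Ss : List (Subset N)
    Ss = allSubsets N
    count-∷ : ∀ b → length (filter P? (map (b ∷_) Ss)) ≡ countSubsets (P? ∘ (b ∷_))
    count-∷ b = trans (cong length (filter-map P? (b ∷_) Ss))
                      (length-map {B = Subset (suc N)} (b ∷_) (filter (P? ∘ (b ∷_)) Ss))

countSubsets-⇔ : ∀ {ℓ} {P Q : Pred (Subset N) ℓ} → (∀ S → P S ⇔ Q S) →
                 (P? : Decidable P) (Q? : Decidable Q) → countSubsets P? ≡ countSubsets Q?
countSubsets-⇔ {N} P⇔Q P? Q? =
  cong length (filter-≐ P? Q? ((λ {S} → to (P⇔Q S)) , (λ {S} → from (P⇔Q S))) (allSubsets N))

countSubsets-empty : ∀ {ℓ} {P : Pred (Subset N) ℓ} (P? : Decidable P) → (∀ S → ¬ P S) → countSubsets P? ≡ 0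
countSubsets-empty {N} P? ∅ = cong length (filter-none P? (All.universal ∅ (allSubsets N)))

module _ (R : Fin (suc N) → Fin (suc N) → Bool) (U : Fin (suc N) → Bool) where

  private
    cliques-filterᵇ-suc : ∀ r V → cliques R r (filterᵇ V (tabulate suc)) ≡ cliques (R on suc) r (filterᵇ (V ∘ suc) (allFin N))
    cliques-filterᵇ-suc r V = begin
      cliques R r (filterᵇ V (tabulate suc))             ≡⟨ cong (cliques R r ∘ filterᵇ V) (map-tabulate (λ i → i) suc) ⟨
      cliques R r (filterᵇ V (map suc (allFin N)))       ≡⟨ cong (cliques R r) (filter-map (T? ∘ V) suc (allFin N)) ⟩
      cliques R r (map suc (filterᵇ (V ∘ suc) (allFin N)))  ≡⟨ cliques-map R suc r _ ⟩
      cliques (R on suc) r (filterᵇ (V ∘ suc) (allFin N))   ∎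
      where open ≡-Reasoning

  cliques-filterᵇ-allFin-suc : ∀ r → cliques R (suc r) (filterᵇ U (allFin (suc N))) ≡
    (if U zero then cliques (R on suc) r (filterᵇ (λ j → U (suc j) ∧ R zero (suc j)) (allFin N)) else 0)
    + cliques (R on suc) (suc r) (filterᵇ (U ∘ suc) (allFin N))
  cliques-filterᵇ-allFin-suc r with U zero
  ... | true  = begin
    cliques R (suc r) (filterᵇ U (tabulate suc)) + cliques R r (filterᵇ (R zero) (filterᵇ U (tabulate suc)))
      ≡⟨ cong₂ _+_ (cliques-filterᵇ-suc (suc r) U)
                   (trans (cong (cliques R r) (filterᵇ-filterᵇ (R zero) U (tabulate suc))) (cliques-filterᵇ-suc r (λ x → U x ∧ R zero x))) ⟩
    cliques (R on suc) (suc r) (filterᵇ (U ∘ suc) (allFin N)) + cliques (R on suc) r (filterᵇ (λ j → U (suc j) ∧ R zero (suc j)) (allFin N))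
      ≡⟨ ℕ.+-comm (cliques (R on suc) (suc r) (filterᵇ (U ∘ suc) (allFin N))) _ ⟩
    cliques (R on suc) r (filterᵇ (λ j → U (suc j) ∧ R zero (suc j)) (allFin N)) + cliques (R on suc) (suc r) (filterᵇ (U ∘ suc) (allFin N))
      ∎
    where open ≡-Reasoning
  ... | false = cliques-filterᵇ-suc (suc r) U

-- The count does not depend on the decision procedure (countSubsets-⇔), so the statement
-- allows any; the recursion transports decisions along cliqueWithin-false∷ and -true∷.
countSubsets-cliqueWithin : (R : Fin N → Fin N → Bool) → (∀ i j → R i j ≡ R j i) →
  ∀ r U (P? : Decidable (CliqueWithin R U r)) → countSubsets P? ≡ cliques R r (filterᵇ U (allFin N))
countSubsets-cliqueWithin {zero} R R-sym zero U P? with P? []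
... | yes _  = refl
... | no ¬P = ⊥-elim (¬P (refl , (λ ()) , λ ()))
countSubsets-cliqueWithin {zero} R R-sym (suc r) U P? with P? []
... | yes (() , _)
... | no _ = refl
countSubsets-cliqueWithin {suc N} R R-sym r U P? = trans (countSubsets-suc P?) (split r P?)
  where
    R⁺-sym : ∀ i j → (R on suc) i j ≡ (R on suc) j i
    R⁺-sym i j = R-sym (suc i) (suc j)

    U⁺∩N₀ : Fin N → Bool
    U⁺∩N₀ j = U (suc j) ∧ R zero (suc j)

    without-zero : ∀ {r} (P? : Decidable (CliqueWithin R U r)) →
      countSubsets (P? ∘ (false ∷_)) ≡ cliques (R on suc) r (filterᵇ (U ∘ suc) (allFin N))
    without-zero {r} P? =
      trans (countSubsets-⇔ (λ S → cliqueWithin-false∷ R U S) (P? ∘ (false ∷_)) Q?)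
            (countSubsets-cliqueWithin (R on suc) R⁺-sym r (U ∘ suc) Q?)
      where
        Q? : Decidable (CliqueWithin (R on suc) (U ∘ suc) r)
        Q? S = Dec.map (cliqueWithin-false∷ R U S) (P? (false ∷ S))

    with-zero : ∀ r (P? : Decidable (CliqueWithin R U (suc r))) →
      countSubsets (P? ∘ (true ∷_)) ≡ (if U zero then cliques (R on suc) r (filterᵇ U⁺∩N₀ (allFin N)) else 0)
    with-zero r P? with U zero in U₀
    ... | true  =
      trans (countSubsets-⇔ restrict (P? ∘ (true ∷_)) Q?)
            (countSubsets-cliqueWithin (R on suc) R⁺-sym r U⁺∩N₀ Q?)
      where
        drop-zero : ∀ {X Y : Set} → X ⇔ (T (U zero) × Y) → X ⇔ Y
        drop-zero X⇔Y = mk⇔ (proj₂ ∘ to X⇔Y) (λ y → from X⇔Y (from T-≡ U₀ , y))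
        restrict : ∀ S → CliqueWithin R U (suc r) (true ∷ S) ⇔ CliqueWithin (R on suc) U⁺∩N₀ r S
        restrict S = drop-zero (cliqueWithin-true∷ R U S R-sym)
        Q? : Decidable (CliqueWithin (R on suc) U⁺∩N₀ r)
        Q? S = Dec.map (restrict S) (P? (true ∷ S))
    ... | false = countSubsets-empty (P? ∘ (true ∷_))
                    (λ S c → subst T U₀ (proj₁ (to (cliqueWithin-true∷ R U S R-sym) c)))

    split : ∀ r (P? : Decidable (CliqueWithin R U r)) →
      countSubsets (P? ∘ (true ∷_)) + countSubsets (P? ∘ (false ∷_)) ≡ cliques R r (filterᵇ U (allFin (suc N)))
    split zero    P? = cong₂ _+_ (countSubsets-empty (P? ∘ (true ∷_)) (λ { _ (() , _) })) (without-zero P?)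
    split (suc r) P? = trans (cong₂ _+_ (with-zero r P?) (without-zero P?)) (sym (cliques-filterᵇ-allFin-suc R U r))

#K≡cliques : (G : Graph N) (r : ℕ) → #K r G ≡ cliques (adj G) r (allFin N)
#K≡cliques {N} G r = begin
  #K r G                                                 ≡⟨ countSubsets-⇔ sizedClique⇔ (T? ∘ sizedCliqueᵇ) P? ⟩
  countSubsets P?                                        ≡⟨ countSubsets-cliqueWithin (adj G) (Graph.sym G) r (λ _ → true) P? ⟩
  cliques (adj G) r (filterᵇ (λ _ → true) (allFin N))    ≡⟨ cong (cliques (adj G) r) (filterᵇ-true (allFin N)) ⟩
  cliques (adj G) r (allFin N)                           ∎
  where
    open ≡-Reasoning
    sizedCliqueᵇ : Subset N → Bool
    sizedCliqueᵇ S = (∣ S ∣ ≡ᵇ r) ∧ isCliqueᵇ G S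
    sizedClique⇔ : ∀ S → T (sizedCliqueᵇ S) ⇔ CliqueWithin (adj G) (λ _ → true) r S
    sizedClique⇔ S = mk⇔
      (λ t → let size , clique = to T-∧ t in ≡ᵇ⇒≡ _ _ size , to (isCliqueᵇ-correct G S) clique , λ _ _ → tt)
      (λ (size , clique , _) → from T-∧ (≡⇒≡ᵇ _ _ size , from (isCliqueᵇ-correct G S) clique))
    P? : Decidable (CliqueWithin (adj G) (λ _ → true) r)
    P? S = Dec.map (sizedClique⇔ S) (T? (sizedCliqueᵇ S))

clique-complement⇒independent : (G : Graph N) {S : Subset N} → IsClique (complement (adj G)) S → IsIndependent G S
clique-complement⇒independent G clique i j i∈S j∈S with i ≟ j
... | yes refl = Graph.irrefl G i
... | no i≢j   = to T-not-≡ (clique i j i∈S j∈S i≢j)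

noIndependentSet⇒cliques-complement≡0 : (G : Graph N) (n : ℕ) → NoIndependentSetOfSize n G →
                                        cliques (complement (adj G)) n (allFin N) ≡ 0
noIndependentSet⇒cliques-complement≡0 {N} G n no-indep = begin
  cliques (complement (adj G)) n (allFin N)                          ≡⟨ cong (cliques (complement (adj G)) n) (filterᵇ-true (allFin N)) ⟨
  cliques (complement (adj G)) n (filterᵇ (λ _ → true) (allFin N))   ≡⟨ countSubsets-cliqueWithin _ complement-sym n (λ _ → true) none? ⟨
  countSubsets none?                                                 ≡⟨ countSubsets-empty none? none ⟩
  0                                                                  ∎
  where
    open ≡-Reasoning
    complement-sym : ∀ i j → complement (adj G) i j ≡ complement (adj G) j i
    complement-sym i j = cong not (Graph.sym G i j)
    none : ∀ S → ¬ CliqueWithin (complement (adj G)) (λ _ → true) n S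
    none S (size , clique , _) = no-indep S size (clique-complement⇒independent G clique)
    none? : Decidable (CliqueWithin (complement (adj G)) (λ _ → true) n)
    none? S = no (none S)

#K-ratio : (G : Graph N) (r n : ℕ) → cliqueRatioConstant r * n ^ r ≤ N → NoIndependentSetOfSize n G →
           N * #K r G ≤ cliqueRatioConstant r * n ^ r * #K (suc r) G
#K-ratio {N} G r n large no-indep = begin
  N * #K r G                                                  ≡⟨ cong₂ _*_ (sym |V|≡N) (#K≡cliques G r) ⟩
  length V * cliques (adj G) r V                              ≤⟨ cliques-ratio (adj G) (Graph.sym G) (Graph.irrefl G) r n V
                                                                   (subst (_ ≤_) (sym |V|≡N) large)
                                                                   (noIndependentSet⇒cliques-complement≡0 G n no-indep) ⟩
  cliqueRatioConstant r * n ^ r * cliques (adj G) (suc r) V   ≡⟨ cong (cliqueRatioConstant r * n ^ r *_) (#K≡cliques G (suc r)) ⟨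
  cliqueRatioConstant r * n ^ r * #K (suc r) G                ∎
  where
    open ≤-Reasoning
    V : List (Fin N)
    V = allFin N
    |V|≡N : length V ≡ N
    |V|≡N = length-tabulate (λ i → i)

lemma5p1 : (r : ℕ) → 1 ≤ r →
    ∃[ C ] (1 ≤ C ×
      ((n : ℕ) → 1 ≤ n → (N : ℕ) → (G : Graph N) →
        N ≥ C * n ^ r →
        NoIndependentSetOfSize n G →
        N * #K r G ≤ C * n ^ r * #K (r + 1) G))
lemma5p1 r _ = cliqueRatioConstant r , cliqueRatioConstant-positive r , λ n _ N G large no-indep →
  subst (λ k → N * #K r G ≤ cliqueRatioConstant r * n ^ r * #K k G) (+-comm 1 r) (#K-ratio G r n large no-indep)
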